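{- The base-cobase graph $G(R_{10},R_{10}^\ast)$ is isomorphic to the graph with vertex set $(S_5/D_5)\cup(S_5/S_2)$ (disjoint union) in which: (1) the neighbors of $[abcde]_{S_2}$ are $[abcde]_{D_5}$, $[cbade]_{S_2}$, $[acbde]_{S_2}$, $[abdce]_{S_2}$, $[abedc]_{S_2}$; (2) the neighbors of $[abcde]_{D_5}$ are $[abcde]_{S_2}$, $[bcdea]_{S_2}$, $[cdeab]_{S_2}$, $[deabc]_{S_2}$, $[eabcd]_{S_2}$.
   Context: $R_{10}$ is the matroid with ground set $\binom{[5]}{3}$ in which a collection of triples is independent iff their incidence vectors in $\mathbb{F}_2^5$ are linearly independent over $\mathbb{F}_2$. A base-cobase is a base whose complement is also a base; $G(R_{10},R_{10}^\ast)$ has the base-cobases as vertices, adjacent iff their symmetric difference has exactly two elements. Permutations of $\{1,2,3,4,5\}$ are written as words $abcde$. $S_5/S_2$ is the set of classes $[abcde]_{S_2}$ of words under the identification $abcde\sim edcba$ (reversal); $S_5/D_5$ is the set of classes $[abcde]_{D_5}$ under the equivalence generated by reversal $abcde\sim edcba$ and cyclic shift $abcde\sim bcdea$. -}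

module Defs where

open import Data.Bool using (Bool; true; false; _xor_; if_then_else_)
open import Data.Nat using (ℕ)
open import Data.Fin using (Fin; zero; suc)
open import Data.Fin.Subset using (Subset; _⊆_; _∉_; ⊥; ⁅_⁆; _∪_; ∁; _─_; ∣_∣)
open import Data.Vec using (Vec; []; _∷_; replicate; zipWith; lookup; foldr; tabulate)
open import Data.Product using (Σ; _×_; ∃; proj₁)
open import Data.Sum using (_⊎_; inj₁; inj₂)
open import Relation.Nullary using (¬_)
open import Relation.Binary.PropositionalEquality using (_≡_)
open import Relation.Binary.Construct.Closure.Equivalence using (EqClosure)

-- The matroid R10.
-- Ground set ([5] choose 3), enumerated as Fin 10 in lexicographic order:
-- 123,124,125,134,135,145,234,235,245,345.
-- The element i of Fin 5 stands for the letter (i+1).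

triple : Fin 10 → Vec Bool 5
triple zero                                                       = true  ∷ true  ∷ true  ∷ false ∷ false ∷ []
triple (suc zero)                                                 = true  ∷ true  ∷ false ∷ true  ∷ false ∷ []
triple (suc (suc zero))                                           = true  ∷ true  ∷ false ∷ false ∷ true  ∷ []
triple (suc (suc (suc zero)))                                     = true  ∷ false ∷ true  ∷ true  ∷ false ∷ []
triple (suc (suc (suc (suc zero))))                               = true  ∷ false ∷ true  ∷ false ∷ true  ∷ []
triple (suc (suc (suc (suc (suc zero)))))                         = true  ∷ false ∷ false ∷ true  ∷ true  ∷ []
triple (suc (suc (suc (suc (suc (suc zero))))))                   = false ∷ true  ∷ true  ∷ true  ∷ false ∷ []
triple (suc (suc (suc (suc (suc (suc (suc zero)))))))             = false ∷ true  ∷ true  ∷ false ∷ true  ∷ []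
triple (suc (suc (suc (suc (suc (suc (suc (suc zero))))))))       = false ∷ true  ∷ false ∷ true  ∷ true  ∷ []
triple (suc (suc (suc (suc (suc (suc (suc (suc (suc zero)))))))))  = false ∷ false ∷ true  ∷ true  ∷ true  ∷ []

_⊕_ : Vec Bool 5 → Vec Bool 5 → Vec Bool 5
_⊕_ = zipWith _xor_

zeroV : Vec Bool 5
zeroV = replicate 5 false

sumF2 : {n : ℕ} → (Fin n → Vec Bool 5) → Subset n → Vec Bool 5
sumF2 v [] = zeroV
sumF2 v (b ∷ Y) = (if b then v zero else zeroV) ⊕ sumF2 (λ i → v (suc i)) Y

Independent : Subset 10 → Set
Independent X = ∀ (Y : Subset 10) → Y ⊆ X → sumF2 triple Y ≡ zeroV → Y ≡ ⊥

IsBase : Subset 10 → Set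
IsBase B = Independent B × (∀ (i : Fin 10) → i ∉ B → ¬ Independent (⁅ i ⁆ ∪ B))

IsBaseCobase : Subset 10 → Set
IsBaseCobase B = IsBase B × IsBase (∁ B)

BCVertex : Set
BCVertex = Σ (Subset 10) IsBaseCobase

_≈BC_ : BCVertex → BCVertex → Set
x ≈BC y = proj₁ x ≡ proj₁ y

AdjBC : BCVertex → BCVertex → Set
AdjBC x y = ∣ (proj₁ x ─ proj₁ y) ∪ (proj₁ y ─ proj₁ x) ∣ ≡ 2

Word : Set
Word = Vec (Fin 5) 5

IsPerm : Word → Set
IsPerm w = ∀ (i j : Fin 5) → lookup w i ≡ lookup w j → i ≡ j

Perm5 : Set
Perm5 = Σ Word IsPerm

rev : Word → Word
rev (a ∷ b ∷ c ∷ d ∷ e ∷ []) = e ∷ d ∷ c ∷ b ∷ a ∷ []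

shift : Word → Word
shift (a ∷ b ∷ c ∷ d ∷ e ∷ []) = b ∷ c ∷ d ∷ e ∷ a ∷ []

RevStep : Word → Word → Set
RevStep u v = v ≡ rev u

DihStep : Word → Word → Set
DihStep u v = (v ≡ rev u) ⊎ (v ≡ shift u)

_~S2_ : Word → Word → Set
_~S2_ = EqClosure RevStep

_~D5_ : Word → Word → Set
_~D5_ = EqClosure DihStep

-- Raw vertices: inj₁ w stands for [w]_{D5}, inj₂ w stands for [w]_{S2}.
RawV : Set
RawV = Word ⊎ Word

_≈R_ : RawV → RawV → Set
inj₁ u ≈R inj₁ v = u ~D5 v
inj₁ u ≈R inj₂ v = Data.Empty.⊥
  where import Data.Empty
inj₂ u ≈R inj₁ v = Data.Empty.⊥
  where import Data.Empty
inj₂ u ≈R inj₂ v = u ~S2 v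

data Listed : RawV → RawV → Set where
  s2-d5 : ∀ a b c d e → Listed (inj₂ (a ∷ b ∷ c ∷ d ∷ e ∷ [])) (inj₁ (a ∷ b ∷ c ∷ d ∷ e ∷ []))
  s2-1  : ∀ a b c d e → Listed (inj₂ (a ∷ b ∷ c ∷ d ∷ e ∷ [])) (inj₂ (c ∷ b ∷ a ∷ d ∷ e ∷ []))
  s2-2  : ∀ a b c d e → Listed (inj₂ (a ∷ b ∷ c ∷ d ∷ e ∷ [])) (inj₂ (a ∷ c ∷ b ∷ d ∷ e ∷ []))
  s2-3  : ∀ a b c d e → Listed (inj₂ (a ∷ b ∷ c ∷ d ∷ e ∷ [])) (inj₂ (a ∷ b ∷ d ∷ c ∷ e ∷ []))
  s2-4  : ∀ a b c d e → Listed (inj₂ (a ∷ b ∷ c ∷ d ∷ e ∷ [])) (inj₂ (a ∷ b ∷ e ∷ d ∷ c ∷ []))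
  d5-0  : ∀ a b c d e → Listed (inj₁ (a ∷ b ∷ c ∷ d ∷ e ∷ [])) (inj₂ (a ∷ b ∷ c ∷ d ∷ e ∷ []))
  d5-1  : ∀ a b c d e → Listed (inj₁ (a ∷ b ∷ c ∷ d ∷ e ∷ [])) (inj₂ (b ∷ c ∷ d ∷ e ∷ a ∷ []))
  d5-2  : ∀ a b c d e → Listed (inj₁ (a ∷ b ∷ c ∷ d ∷ e ∷ [])) (inj₂ (c ∷ d ∷ e ∷ a ∷ b ∷ []))
  d5-3  : ∀ a b c d e → Listed (inj₁ (a ∷ b ∷ c ∷ d ∷ e ∷ [])) (inj₂ (d ∷ e ∷ a ∷ b ∷ c ∷ []))
  d5-4  : ∀ a b c d e → Listed (inj₁ (a ∷ b ∷ c ∷ d ∷ e ∷ [])) (inj₂ (e ∷ a ∷ b ∷ c ∷ d ∷ []))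

QVertex : Set
QVertex = Perm5 ⊎ Perm5

raw : QVertex → RawV
raw (inj₁ p) = inj₁ (proj₁ p)
raw (inj₂ p) = inj₂ (proj₁ p)

_≈Q_ : QVertex → QVertex → Set
x ≈Q y = raw x ≈R raw y

AdjQ : QVertex → QVertex → Set
AdjQ x y = Σ RawV (λ w → (w ≈R raw x) × Σ RawV (λ n → Listed w n × (n ≈R raw y)))

record GraphIso (V₁ : Set) (_≈₁_ : V₁ → V₁ → Set) (A₁ : V₁ → V₁ → Set)
                (V₂ : Set) (_≈₂_ : V₂ → V₂ → Set) (A₂ : V₂ → V₂ → Set) : Set where
  field
    to       : V₁ → V₂
    from     : V₂ → V₁
    to-cong  : ∀ {x y} → x ≈₁ y → to x ≈₂ to y
    from-cong : ∀ {x y} → x ≈₂ y → from x ≈₁ from y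
    from∘to  : ∀ x → from (to x) ≈₁ x
    to∘from  : ∀ y → to (from y) ≈₂ y
    adj-to   : ∀ x y → A₁ x y → A₂ (to x) (to y)
    adj-from : ∀ x y → A₂ (to x) (to y) → A₁ x y

-- Identify a triple with the pair of letters it omits: R10 becomes a matroid on the edges of
-- K5.  Its base-cobases are exactly the 5-edge sets that are either a Hamiltonian cycle
-- a-b-c-d-e-a, which depends only on the dihedral class [abcde]_{D5}, or a path a-b-c-d-e
-- with the chord b-d, which depends only on the reversal class [abcde]_{S2}; and two such
-- sets differ by a single exchange exactly when their classes are related as listed.  The
-- invariance under the identifications is a symmetry of unions; the rest is finite and is
-- decided exhaustively, over all subsets of the ground set, over all words, and over pairs
-- from a table with one representative of each of the 72 classes.
module Submission where

open import Defs hiding (_⊕_)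
-- fromNat and the instance tt must be in scope for the overloaded number literals
open import Agda.Builtin.FromNat using (Number; fromNat)
open import Data.Unit using (tt)
import Algebra.Solver.CommutativeMonoid as CommutativeMonoidSolver
open import Data.Bool using (Bool; T; not; _∨_; _∧_)
open import Data.Bool.Properties using (∨-comm; T-∧) renaming (_≟_ to _≟ᵇ_)
open import Data.Fin using (Fin)
import Data.Fin.Literals
open import Data.Fin.Properties using (all?) renaming (_≟_ to _≟ᶠ_)
open import Data.Fin.Subset using (Subset; inside; outside; _⊆_; ⁅_⁆; _∪_; ∁; _─_; ∣_∣)
  renaming (⊥ to ∅)
open import Data.Fin.Subset.Properties
  using (drop-∷-⊆; out⊆; in⊆in; ⊆-refl; _∈?_; ∪-commutativeMonoid)
open import Data.List using (List; []; _∷_; _++_; map)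
open import Data.List.Membership.Propositional using (_∈_)
import Data.List.Relation.Unary.All as All
open All using (All)
import Data.List.Relation.Unary.Any as Any
open Any using (Any; here; there)
open import Data.List.Relation.Unary.Any.Properties using (lookup-result)
open import Data.Nat using (ℕ; zero; suc) renaming (_≟_ to _≟ⁿ_)
import Data.Nat.Literals
open import Data.Product using (Σ; _×_; _,_; proj₁; proj₂)
open import Data.Sum using (inj₁; inj₂; [_,_])
import Data.Sum.Properties as Sum
open import Data.Vec using (Vec; []; _∷_; here; lookup; tabulate)
import Data.Vec.Properties as Vec
open import Function using (_∘_; id; _⇔_; mk⇔; Equivalence)
open import Function.Properties.Equivalence using (⇔-isEquivalence)
open import Relation.Binary.Core using (_=[_]⇒_)
open import Relation.Binary.Definitions using (DecidableEquality)
open import Relation.Binary.PropositionalEquality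
  using (_≡_; refl; sym; cong; subst; subst₂; isEquivalence; module ≡-Reasoning)
open import Relation.Binary.Construct.Closure.Equivalence using (gfold)
open import Relation.Binary.Construct.Closure.ReflexiveTransitive using (ε; _◅_)
open import Relation.Binary.Construct.Closure.Symmetric using (bwd)
open import Relation.Nullary using (does; Dec; yes; no; ¬?; contradiction)
open import Relation.Nullary.Decidable using (map′; _×-dec_; _→-dec_)
open import Relation.Unary using (Pred; Decidable)

instance
  natLiterals : Number ℕ
  natLiterals = Data.Nat.Literals.number
  finLiterals : ∀ {n} → Number (Fin n)
  finLiterals = Data.Fin.Literals.number _

-- Unlike toWitness, this only needs the does field of the decision to reduce.
decide : ∀ {a} {A : Set a} (a? : Dec A) → T (does a?) → A
decide (yes a) _ = a

allSubsetsOf? : ∀ {n p} {P : Pred (Subset n) p} → Decidable P →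
                (X : Subset n) → Dec (∀ Y → Y ⊆ X → P Y)
allSubsetsOf? P? [] = map′ (λ { P[] [] _ → P[] }) (λ ∀P → ∀P [] ⊆-refl) (P? [])
allSubsetsOf? {P = P} P? (outside ∷ X) = map′ extend restrict (allSubsetsOf? (P? ∘ (outside ∷_)) X)
  where
  extend : (∀ Y → Y ⊆ X → P (outside ∷ Y)) → ∀ Y → Y ⊆ outside ∷ X → P Y
  extend ∀P (outside ∷ Y) Y⊆ = ∀P Y (drop-∷-⊆ Y⊆)
  extend ∀P (inside ∷ Y) Y⊆ = contradiction (Y⊆ here) λ ()
  restrict : (∀ Y → Y ⊆ outside ∷ X → P Y) → ∀ Y → Y ⊆ X → P (outside ∷ Y)
  restrict ∀P Y Y⊆X = ∀P (outside ∷ Y) (out⊆ Y⊆X)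
allSubsetsOf? {P = P} P? (inside ∷ X) =
  map′ extend restrict
    (allSubsetsOf? (P? ∘ (outside ∷_)) X ×-dec allSubsetsOf? (P? ∘ (inside ∷_)) X)
  where
  extend : (∀ Y → Y ⊆ X → P (outside ∷ Y)) × (∀ Y → Y ⊆ X → P (inside ∷ Y)) →
           ∀ Y → Y ⊆ inside ∷ X → P Y
  extend (∀P₀ , ∀P₁) (outside ∷ Y) Y⊆ = ∀P₀ Y (drop-∷-⊆ Y⊆)
  extend (∀P₀ , ∀P₁) (inside ∷ Y) Y⊆ = ∀P₁ Y (drop-∷-⊆ Y⊆)
  restrict : (∀ Y → Y ⊆ inside ∷ X → P Y) →
             (∀ Y → Y ⊆ X → P (outside ∷ Y)) × (∀ Y → Y ⊆ X → P (inside ∷ Y))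
  restrict ∀P = (λ Y Y⊆X → ∀P (outside ∷ Y) (out⊆ Y⊆X)) , (λ Y Y⊆X → ∀P (inside ∷ Y) (in⊆in Y⊆X))

-- Enumerating Booleans rather than decisions keeps the normalisation of all 2ⁿ cases small.
allSubsetsᵇ : ∀ {n} → (Subset n → Bool) → Bool
allSubsetsᵇ {zero} f = f []
allSubsetsᵇ {suc n} f = allSubsetsᵇ (f ∘ (outside ∷_)) ∧ allSubsetsᵇ (f ∘ (inside ∷_))

allSubsetsᵇ-sound : ∀ {n} (f : Subset n → Bool) → T (allSubsetsᵇ f) → ∀ Y → T (f Y)
allSubsetsᵇ-sound {zero} f t [] = t
allSubsetsᵇ-sound {suc n} f t (outside ∷ Y) =
  allSubsetsᵇ-sound (f ∘ (outside ∷_)) (proj₁ (Equivalence.to T-∧ t)) Y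
allSubsetsᵇ-sound {suc n} f t (inside ∷ Y) =
  allSubsetsᵇ-sound (f ∘ (inside ∷_)) (proj₂ (Equivalence.to T-∧ t)) Y

decideForAllSubsets : ∀ {n p} {P : Pred (Subset n) p} (P? : Decidable P) →
                      T (allSubsetsᵇ (does ∘ P?)) → ∀ Y → P Y
decideForAllSubsets P? t Y = decide (P? Y) (allSubsetsᵇ-sound (does ∘ P?) t Y)

allVec? : ∀ {k n p} {P : Pred (Vec (Fin k) n) p} → Decidable P → Dec (∀ v → P v)
allVec? {n = zero} P? = map′ (λ { P[] [] → P[] }) (λ ∀P → ∀P []) (P? [])
allVec? {n = suc n} P? =
  map′ (λ { ∀P (x ∷ xs) → ∀P x xs }) (λ ∀P x xs → ∀P (x ∷ xs)) (all? λ x → allVec? (P? ∘ (x ∷_)))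

_⇔?_ : ∀ {a b} {A : Set a} {B : Set b} → Dec A → Dec B → Dec (A ⇔ B)
A? ⇔? B? = map′ (λ (f , g) → mk⇔ f g) (λ A⇔B → Equivalence.to A⇔B , Equivalence.from A⇔B)
                ((A? →-dec B?) ×-dec (B? →-dec A?))

_≟ˢ_ : ∀ {n} → DecidableEquality (Subset n)
_≟ˢ_ = Vec.≡-dec _≟ᵇ_

module _ {a p} {A : Set a} {P : Pred A p} (default : A) where

  chooseAny : ∀ {xs} → Dec (Any P xs) → A
  chooseAny (yes x∈) = Any.lookup x∈
  chooseAny (no _) = default

  chooseAny-satisfies : ∀ {xs} (d : Dec (Any P xs)) → Any P xs → P (chooseAny d)
  chooseAny-satisfies (yes x∈) _ = lookup-result x∈
  chooseAny-satisfies (no x∉) x∈ = contradiction x∈ x∉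

  chooseAny-All : ∀ {q} {Q : Pred A q} {xs} → Q default → All Q xs →
                  (d : Dec (Any P xs)) → Q (chooseAny d)
  chooseAny-All _ allQ (yes x∈) = All.lookupAny allQ x∈ .proj₁
  chooseAny-All Qdefault _ (no _) = Qdefault

module _ {n : ℕ} where
  open CommutativeMonoidSolver (∪-commutativeMonoid n)

  ∪-rotate : ∀ (x₁ x₂ x₃ x₄ x₅ : Subset n) → x₂ ∪ x₃ ∪ x₄ ∪ x₅ ∪ x₁ ≡ x₁ ∪ x₂ ∪ x₃ ∪ x₄ ∪ x₅
  ∪-rotate x₁ x₂ x₃ x₄ x₅ =
    prove 5 (var 1 ⊕ var 2 ⊕ var 3 ⊕ var 4 ⊕ var 0) (var 0 ⊕ var 1 ⊕ var 2 ⊕ var 3 ⊕ var 4)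
      (x₁ ∷ x₂ ∷ x₃ ∷ x₄ ∷ x₅ ∷ [])

  ∪-reverse₄ : ∀ (x₁ x₂ x₃ x₄ x₅ : Subset n) → x₄ ∪ x₃ ∪ x₂ ∪ x₁ ∪ x₅ ≡ x₁ ∪ x₂ ∪ x₃ ∪ x₄ ∪ x₅
  ∪-reverse₄ x₁ x₂ x₃ x₄ x₅ =
    prove 5 (var 3 ⊕ var 2 ⊕ var 1 ⊕ var 0 ⊕ var 4) (var 0 ⊕ var 1 ⊕ var 2 ⊕ var 3 ⊕ var 4)
      (x₁ ∷ x₂ ∷ x₃ ∷ x₄ ∷ x₅ ∷ [])

∪₅-cong : ∀ {n} {x₁ x₂ x₃ x₄ x₅ y₁ y₂ y₃ y₄ y₅ : Subset n} →
          x₁ ≡ y₁ → x₂ ≡ y₂ → x₃ ≡ y₃ → x₄ ≡ y₄ → x₅ ≡ y₅ →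
          x₁ ∪ x₂ ∪ x₃ ∪ x₄ ∪ x₅ ≡ y₁ ∪ y₂ ∪ y₃ ∪ y₄ ∪ y₅
∪₅-cong refl refl refl refl refl = refl

independent? : Decidable Independent
independent? = allSubsetsOf? λ Y → (sumF2 triple Y ≟ˢ zeroV) →-dec (Y ≟ˢ ∅)

isBase? : Decidable IsBase
isBase? B = independent? B ×-dec all? λ i → ¬? (i ∈? B) →-dec ¬? (independent? (⁅ i ⁆ ∪ B))

isBaseCobase? : Decidable IsBaseCobase
isBaseCobase? B = isBase? B ×-dec isBase? (∁ B)

SymDiff₂ : ∀ {n} → Subset n → Subset n → Set
SymDiff₂ X Y = ∣ (X ─ Y) ∪ (Y ─ X) ∣ ≡ 2

symDiff₂? : ∀ {n} (X Y : Subset n) → Dec (SymDiff₂ X Y)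
symDiff₂? X Y = ∣ (X ─ Y) ∪ (Y ─ X) ∣ ≟ⁿ 2

-- Hamiltonian cycles and chorded paths of K5

-- For x ≢ y this is the singleton of the triple omitting x and y.
avoiding : Fin 5 → Fin 5 → Subset 10
avoiding x y = tabulate λ t → not (lookup (triple t) x ∨ lookup (triple t) y)

avoiding-sym : ∀ x y → avoiding x y ≡ avoiding y x
avoiding-sym x y =
  Vec.tabulate-cong λ t → cong not (∨-comm (lookup (triple t) x) (lookup (triple t) y))

cycleTriples : Word → Subset 10
cycleTriples (a ∷ b ∷ c ∷ d ∷ e ∷ []) =
  avoiding a b ∪ avoiding b c ∪ avoiding c d ∪ avoiding d e ∪ avoiding e a

chordedPathTriples : Word → Subset 10
chordedPathTriples (a ∷ b ∷ c ∷ d ∷ e ∷ []) =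
  avoiding a b ∪ avoiding b c ∪ avoiding c d ∪ avoiding d e ∪ avoiding b d

cycleTriples-rev : ∀ u → cycleTriples (rev u) ≡ cycleTriples u
cycleTriples-rev (a ∷ b ∷ c ∷ d ∷ e ∷ []) = begin
  avoiding e d ∪ avoiding d c ∪ avoiding c b ∪ avoiding b a ∪ avoiding a e
    ≡⟨ ∪-reverse₄ (avoiding b a) (avoiding c b) (avoiding d c) (avoiding e d) (avoiding a e) ⟩
  avoiding b a ∪ avoiding c b ∪ avoiding d c ∪ avoiding e d ∪ avoiding a e
    ≡⟨ ∪₅-cong (avoiding-sym b a) (avoiding-sym c b) (avoiding-sym d c) (avoiding-sym e d)
               (avoiding-sym a e) ⟩
  avoiding a b ∪ avoiding b c ∪ avoiding c d ∪ avoiding d e ∪ avoiding e a ∎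
  where open ≡-Reasoning

cycleTriples-shift : ∀ u → cycleTriples (shift u) ≡ cycleTriples u
cycleTriples-shift (a ∷ b ∷ c ∷ d ∷ e ∷ []) =
  ∪-rotate (avoiding a b) (avoiding b c) (avoiding c d) (avoiding d e) (avoiding e a)

chordedPathTriples-rev : ∀ u → chordedPathTriples (rev u) ≡ chordedPathTriples u
chordedPathTriples-rev (a ∷ b ∷ c ∷ d ∷ e ∷ []) = begin
  avoiding e d ∪ avoiding d c ∪ avoiding c b ∪ avoiding b a ∪ avoiding d b
    ≡⟨ ∪-reverse₄ (avoiding b a) (avoiding c b) (avoiding d c) (avoiding e d) (avoiding d b) ⟩
  avoiding b a ∪ avoiding c b ∪ avoiding d c ∪ avoiding e d ∪ avoiding d b
    ≡⟨ ∪₅-cong (avoiding-sym b a) (avoiding-sym c b) (avoiding-sym d c) (avoiding-sym e d)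
               (avoiding-sym d b) ⟩
  avoiding a b ∪ avoiding b c ∪ avoiding c d ∪ avoiding d e ∪ avoiding b d ∎
  where open ≡-Reasoning

triplesOf : RawV → Subset 10
triplesOf (inj₁ u) = cycleTriples u
triplesOf (inj₂ u) = chordedPathTriples u

triplesOf-cong : ∀ r s → r ≈R s → triplesOf r ≡ triplesOf s
triplesOf-cong (inj₁ _) (inj₁ _) = gfold isEquivalence cycleTriples dihedral-invariant
  where
  dihedral-invariant : DihStep =[ cycleTriples ]⇒ _≡_
  dihedral-invariant {u} (inj₁ refl) = sym (cycleTriples-rev u)
  dihedral-invariant {u} (inj₂ refl) = sym (cycleTriples-shift u)
triplesOf-cong (inj₂ _) (inj₂ _) =
  gfold isEquivalence chordedPathTriples λ { {u} refl → sym (chordedPathTriples-rev u) }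

word : RawV → Word
word = [ id , id ]

isPerm? : Decidable IsPerm
isPerm? w = all? λ i → all? λ j → (lookup w i ≟ᶠ lookup w j) →-dec (i ≟ᶠ j)

isPerm-rev : ∀ u → IsPerm u ⇔ IsPerm (rev u)
isPerm-rev = decide (allVec? λ u → isPerm? u ⇔? isPerm? (rev u)) _

isPerm-shift : ∀ u → IsPerm u ⇔ IsPerm (shift u)
isPerm-shift = decide (allVec? λ u → isPerm? u ⇔? isPerm? (shift u)) _

isPerm-cong : ∀ r s → r ≈R s → IsPerm (word r) ⇔ IsPerm (word s)
isPerm-cong (inj₁ _) (inj₁ _) = gfold ⇔-isEquivalence IsPerm dihedral-invariant
  where
  dihedral-invariant : DihStep =[ IsPerm ]⇒ _⇔_
  dihedral-invariant {u} (inj₁ refl) = isPerm-rev u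
  dihedral-invariant {u} (inj₂ refl) = isPerm-shift u
isPerm-cong (inj₂ _) (inj₂ _) = gfold ⇔-isEquivalence IsPerm λ { {u} refl → isPerm-rev u }

raw-isPerm : ∀ q → IsPerm (word (raw q))
raw-isPerm (inj₁ (_ , perm)) = perm
raw-isPerm (inj₂ (_ , perm)) = perm

allRawV? : ∀ {p} {P : Pred RawV p} → Decidable P → Dec (∀ r → P r)
allRawV? P? = map′ (λ (∀P₁ , ∀P₂) → [ ∀P₁ , ∀P₂ ]) (λ ∀P → ∀P ∘ inj₁ , ∀P ∘ inj₂)
                   (allVec? (P? ∘ inj₁) ×-dec allVec? (P? ∘ inj₂))

_≟ᴿ_ : DecidableEquality RawV
_≟ᴿ_ = Sum.≡-dec (Vec.≡-dec _≟ᶠ_) (Vec.≡-dec _≟ᶠ_)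

≈R-reflexive : ∀ {r s} → r ≡ s → r ≈R s
≈R-reflexive {inj₁ _} refl = ε
≈R-reflexive {inj₂ _} refl = ε

rotations : ∀ {u} → ℕ → (v : Word) → v ~D5 u → List (Σ Word (_~D5 u))
rotations zero v v~u = []
rotations (suc k) v v~u = (v , v~u) ∷ rotations k (shift v) (bwd (inj₂ refl) ◅ v~u)

orbit : (r : RawV) → List (Σ RawV (_≈R r))
orbit (inj₁ u) =
  map (λ (v , v~u) → inj₁ v , v~u) (rotations 5 u ε ++ rotations 5 (rev u) (bwd (inj₁ refl) ◅ ε))
orbit (inj₂ u) = (inj₂ u , ε) ∷ (inj₂ (rev u) , bwd refl ◅ ε) ∷ []

InOrbit : RawV → RawV → Set
InOrbit r s = Any ((r ≡_) ∘ proj₁) (orbit s)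

inOrbit? : ∀ r s → Dec (InOrbit r s)
inOrbit? r s = Any.any? ((r ≟ᴿ_) ∘ proj₁) (orbit s)

inOrbit⇒≈R : ∀ {r s} → InOrbit r s → r ≈R s
inOrbit⇒≈R r∈ with Any.satisfied r∈
... | (m , m≈s) , refl = m≈s

neighbours : (r : RawV) → List (Σ RawV (Listed r))
neighbours (inj₁ (a ∷ b ∷ c ∷ d ∷ e ∷ [])) =
  (_ , d5-0 a b c d e) ∷ (_ , d5-1 a b c d e) ∷ (_ , d5-2 a b c d e) ∷ (_ , d5-3 a b c d e) ∷
  (_ , d5-4 a b c d e) ∷ []
neighbours (inj₂ (a ∷ b ∷ c ∷ d ∷ e ∷ [])) =
  (_ , s2-d5 a b c d e) ∷ (_ , s2-1 a b c d e) ∷ (_ , s2-2 a b c d e) ∷ (_ , s2-3 a b c d e) ∷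
  (_ , s2-4 a b c d e) ∷ []

listed∈neighbours : ∀ {r n} (L : Listed r n) → (n , L) ∈ neighbours r
listed∈neighbours (d5-0 _ _ _ _ _) = here refl
listed∈neighbours (d5-1 _ _ _ _ _) = there (here refl)
listed∈neighbours (d5-2 _ _ _ _ _) = there (there (here refl))
listed∈neighbours (d5-3 _ _ _ _ _) = there (there (there (here refl)))
listed∈neighbours (d5-4 _ _ _ _ _) = there (there (there (there (here refl))))
listed∈neighbours (s2-d5 _ _ _ _ _) = here refl
listed∈neighbours (s2-1 _ _ _ _ _) = there (here refl)
listed∈neighbours (s2-2 _ _ _ _ _) = there (there (here refl))
listed∈neighbours (s2-3 _ _ _ _ _) = there (there (there (here refl)))
listed∈neighbours (s2-4 _ _ _ _ _) = there (there (there (there (here refl))))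

ListedNeighbour : RawV → RawV → Set
ListedNeighbour r s = Any (λ (n , _) → InOrbit n s) (neighbours r)

listedNeighbour? : ∀ r s → Dec (ListedNeighbour r s)
listedNeighbour? r s = Any.any? (λ (n , _) → inOrbit? n s) (neighbours r)

listedNeighbour⇒AdjQ : ∀ x y → ListedNeighbour (raw x) (raw y) → AdjQ x y
listedNeighbour⇒AdjQ x y n∈ with Any.satisfied n∈
... | (n , L) , n∼y = raw x , ≈R-reflexive refl , n , L , inOrbit⇒≈R n∼y

-- The 72 classes

d5 s2 : (a b c d e : Fin 5) → {T (does (isPerm? (a ∷ b ∷ c ∷ d ∷ e ∷ [])))} → QVertex
d5 a b c d e {perm} = inj₁ (a ∷ b ∷ c ∷ d ∷ e ∷ [] , decide (isPerm? (a ∷ b ∷ c ∷ d ∷ e ∷ [])) perm)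
s2 a b c d e {perm} = inj₂ (a ∷ b ∷ c ∷ d ∷ e ∷ [] , decide (isPerm? (a ∷ b ∷ c ∷ d ∷ e ∷ [])) perm)

classes : List QVertex
classes =
  d5 0 1 2 3 4 ∷ d5 0 1 2 4 3 ∷ d5 0 1 3 2 4 ∷ d5 0 1 3 4 2 ∷ d5 0 1 4 2 3 ∷ d5 0 1 4 3 2 ∷
  d5 0 2 1 3 4 ∷ d5 0 2 1 4 3 ∷ d5 0 2 3 1 4 ∷ d5 0 2 4 1 3 ∷ d5 0 3 1 2 4 ∷ d5 0 3 2 1 4 ∷
  s2 0 1 2 3 4 ∷ s2 0 1 2 4 3 ∷ s2 0 1 3 2 4 ∷ s2 0 1 3 4 2 ∷ s2 0 1 4 2 3 ∷ s2 0 1 4 3 2 ∷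
  s2 0 2 1 3 4 ∷ s2 0 2 1 4 3 ∷ s2 0 2 3 1 4 ∷ s2 0 2 3 4 1 ∷ s2 0 2 4 1 3 ∷ s2 0 2 4 3 1 ∷
  s2 0 3 1 2 4 ∷ s2 0 3 1 4 2 ∷ s2 0 3 2 1 4 ∷ s2 0 3 2 4 1 ∷ s2 0 3 4 1 2 ∷ s2 0 3 4 2 1 ∷
  s2 0 4 1 2 3 ∷ s2 0 4 1 3 2 ∷ s2 0 4 2 1 3 ∷ s2 0 4 2 3 1 ∷ s2 0 4 3 1 2 ∷ s2 0 4 3 2 1 ∷
  s2 1 0 2 3 4 ∷ s2 1 0 2 4 3 ∷ s2 1 0 3 2 4 ∷ s2 1 0 3 4 2 ∷ s2 1 0 4 2 3 ∷ s2 1 0 4 3 2 ∷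
  s2 1 2 0 3 4 ∷ s2 1 2 0 4 3 ∷ s2 1 2 3 0 4 ∷ s2 1 2 4 0 3 ∷ s2 1 3 0 2 4 ∷ s2 1 3 0 4 2 ∷
  s2 1 3 2 0 4 ∷ s2 1 3 4 0 2 ∷ s2 1 4 0 2 3 ∷ s2 1 4 0 3 2 ∷ s2 1 4 2 0 3 ∷ s2 1 4 3 0 2 ∷
  s2 2 0 1 3 4 ∷ s2 2 0 1 4 3 ∷ s2 2 0 3 1 4 ∷ s2 2 0 4 1 3 ∷ s2 2 1 0 3 4 ∷ s2 2 1 0 4 3 ∷
  s2 2 1 3 0 4 ∷ s2 2 1 4 0 3 ∷ s2 2 3 0 1 4 ∷ s2 2 3 1 0 4 ∷ s2 2 4 0 1 3 ∷ s2 2 4 1 0 3 ∷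
  s2 3 0 1 2 4 ∷ s2 3 0 2 1 4 ∷ s2 3 1 0 2 4 ∷ s2 3 1 2 0 4 ∷ s2 3 2 0 1 4 ∷ s2 3 2 1 0 4 ∷ []

classTriples : QVertex → Subset 10
classTriples = triplesOf ∘ raw

Encodes : Subset 10 → QVertex → Set
Encodes B q = classTriples q ≡ B

encodedBy? : ∀ B → Dec (Any (Encodes B) classes)
encodedBy? B = Any.any? (λ q → classTriples q ≟ˢ B) classes

classOf : Subset 10 → QVertex
classOf B = chooseAny (d5 0 1 2 3 4) (encodedBy? B)

classOf-All : ∀ {p} {P : Pred QVertex p} → All P classes → ∀ B → P (classOf B)
classOf-All allP B = chooseAny-All (d5 0 1 2 3 4) (All.head allP) allP (encodedBy? B)

classes-isBaseCobase : All (IsBaseCobase ∘ classTriples) classes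
classes-isBaseCobase = decide (All.all? (isBaseCobase? ∘ classTriples) classes) _

classes-cover : ∀ B → IsBaseCobase B → Any (Encodes B) classes
classes-cover = decideForAllSubsets (λ B → isBaseCobase? B →-dec encodedBy? B) _

classOf-triplesOf : ∀ r → IsPerm (word r) → InOrbit (raw (classOf (triplesOf r))) r
classOf-triplesOf =
  decide (allRawV? λ r → isPerm? (word r) →-dec inOrbit? (raw (classOf (triplesOf r))) r) _

NeighboursExchange : RawV → Set
NeighboursExchange r = All (λ (n , _) → SymDiff₂ (triplesOf r) (triplesOf n)) (neighbours r)

neighboursExchange : ∀ r → IsPerm (word r) → NeighboursExchange r
neighboursExchange = decide (allRawV? λ r → isPerm? (word r) →-dec neighboursExchange? r) _
  where
  neighboursExchange? : ∀ r → Dec (NeighboursExchange r)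
  neighboursExchange? r =
    All.all? (λ (n , _) → symDiff₂? (triplesOf r) (triplesOf n)) (neighbours r)

ExchangeListed : QVertex → QVertex → Set
ExchangeListed q q′ = SymDiff₂ (classTriples q) (classTriples q′) → ListedNeighbour (raw q) (raw q′)

classes-exchangeListed : All (λ q → All (ExchangeListed q) classes) classes
classes-exchangeListed = decide (All.all? (λ q → All.all? (exchangeListed? q) classes) classes) _
  where
  exchangeListed? : ∀ q q′ → Dec (ExchangeListed q q′)
  exchangeListed? q q′ =
    symDiff₂? (classTriples q) (classTriples q′) →-dec listedNeighbour? (raw q) (raw q′)

classTriples-classOf : ∀ B → IsBaseCobase B → classTriples (classOf B) ≡ B
classTriples-classOf B bc = chooseAny-satisfies (d5 0 1 2 3 4) (encodedBy? B) (classes-cover B bc)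

triplesOf-isBaseCobase : ∀ r → IsPerm (word r) → IsBaseCobase (triplesOf r)
triplesOf-isBaseCobase r perm =
  subst IsBaseCobase (triplesOf-cong _ r (inOrbit⇒≈R (classOf-triplesOf r perm)))
    (classOf-All classes-isBaseCobase (triplesOf r))

symDiff₂⇒listedNeighbour : ∀ B B′ → IsBaseCobase B → IsBaseCobase B′ →
                           SymDiff₂ B B′ → ListedNeighbour (raw (classOf B)) (raw (classOf B′))
symDiff₂⇒listedNeighbour B B′ bc bc′ =
  classOf-All (classOf-All classes-exchangeListed B) B′
  ∘ subst₂ SymDiff₂ (sym (classTriples-classOf B bc)) (sym (classTriples-classOf B′ bc′))

adjQ⇒symDiff₂ : ∀ q q′ → AdjQ q q′ → SymDiff₂ (classTriples q) (classTriples q′)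
adjQ⇒symDiff₂ q q′ (w , w≈q , n , L , n≈q′) =
  subst₂ SymDiff₂ (triplesOf-cong w (raw q) w≈q) (triplesOf-cong n (raw q′) n≈q′)
    (All.lookup (neighboursExchange w w-perm) (listed∈neighbours L))
  where
  w-perm : IsPerm (word w)
  w-perm = Equivalence.from (isPerm-cong w (raw q) w≈q) (raw-isPerm q)

classToBase : QVertex → BCVertex
classToBase q = classTriples q , triplesOf-isBaseCobase (raw q) (raw-isPerm q)

theorem5p4 : GraphIso BCVertex _≈BC_ AdjBC QVertex _≈Q_ AdjQ
theorem5p4 = record
  { to        = classOf ∘ proj₁
  ; from      = classToBase
  ; to-cong   = ≈R-reflexive ∘ cong (raw ∘ classOf)
  ; from-cong = λ {q} {q′} → triplesOf-cong (raw q) (raw q′)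
  ; from∘to   = λ (B , bc) → classTriples-classOf B bc
  ; to∘from   = λ q → inOrbit⇒≈R (classOf-triplesOf (raw q) (raw-isPerm q))
  ; adj-to    = λ (B , bc) (B′ , bc′) →
      listedNeighbour⇒AdjQ (classOf B) (classOf B′) ∘ symDiff₂⇒listedNeighbour B B′ bc bc′
  ; adj-from  = λ (B , bc) (B′ , bc′) →
      subst₂ SymDiff₂ (classTriples-classOf B bc) (classTriples-classOf B′ bc′)
      ∘ adjQ⇒symDiff₂ (classOf B) (classOf B′)
  }
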